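{- Let $n$ and $d$ be natural numbers ($n,d \ge 1$), and let $\pi$ be any permutation of the set of residues $\{0,1,\dots,d-1\}$ modulo $d$. Then the number of partitions of $n$ into parts any two of which differ by at least $d$ equals the number of partitions $\lambda$ of $n$ into pairwise distinct parts satisfying the following conditions $c_1,\dots,c_{d-1}$: for each $s \in \{1,\dots,d-1\}$, condition $c_s$ states that every part of $\lambda$ congruent to $\pi(s) \pmod d$ is strictly greater than $d \cdot N_s$, where $N_s$ is the total number of parts of $\lambda$ that are congruent modulo $d$ to one of $\pi(0),\pi(1),\dots,\pi(s-1)$.
   Context: A partition of a natural number $n$ is a representation of $n$ as a sum of positive integers (its parts), listed in non-increasing order; two partitions are the same if they have the same multiset of parts. A partition is called $d$-distinct if any two of its parts differ by at least $d$; $1$-distinct means all parts are pairwise distinct. -}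

module Defs where

open import Data.Nat using (ℕ; _+_; _*_; _≤_; _<_; _<?_; NonZero)
open import Data.Nat.DivMod using (_%_)
open import Data.Nat.Properties using (_≟_)
open import Data.Fin using (Fin; toℕ)
open import Data.Fin.Properties using (any?)
open import Data.Fin.Permutation using (Permutation′; _⟨$⟩ʳ_)
open import Data.List using (List; length; lookup; filter)
open import Data.Nat.ListAction using (sum)
open import Data.List.Relation.Unary.All using (All)
open import Data.List.Relation.Unary.Linked using (Linked)
open import Data.Nat using (_≥_)
open import Data.List.Membership.Propositional using (_∈_)
open import Data.Product using (Σ; _×_)
open import Relation.Nullary.Decidable using (_×-dec_)
open import Relation.Binary.PropositionalEquality using (_≡_)
import Data.Nat.Properties as ℕP

IsPartition : ℕ → List ℕ → Set
IsPartition n l = Linked _≥_ l × All (λ p → 1 ≤ p) l × sum l ≡ n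

DDistinct : ℕ → List ℕ → Set
DDistinct d l = (i j : Fin (length l)) → toℕ i < toℕ j → lookup l j + d ≤ lookup l i

-- The subset of lists satisfying P; the proof field is irrelevant, so two
-- elements are equal exactly when their underlying lists (partitions) are equal.
record Subset (P : List ℕ → Set) : Set where
  constructor _,_
  field
    parts : List ℕ
    .valid : P parts

DDistinctPartition : ℕ → ℕ → Set
DDistinctPartition d n = Subset (λ l → IsPartition n l × DDistinct d l)

Nₛ : (d : ℕ) .{{_ : NonZero d}} → Permutation′ d → ℕ → List ℕ → ℕ
Nₛ d π s l = length (filter (λ p → any? (λ k → (toℕ k <? s) ×-dec (p % d ≟ toℕ (π ⟨$⟩ʳ k)))) l)

Conditions : (d : ℕ) .{{_ : NonZero d}} → Permutation′ d → List ℕ → Set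
Conditions d π l = (s : Fin d) → 1 ≤ toℕ s →
  (p : ℕ) → p ∈ l → p % d ≡ toℕ (π ⟨$⟩ʳ s) → d * Nₛ d π (toℕ s) l < p

CondPartition : (d : ℕ) .{{_ : NonZero d}} → Permutation′ d → ℕ → Set
CondPartition d π n = Subset (λ l → (IsPartition n l × DDistinct 1 l) × Conditions d π l)

-- Subtracting the staircase d(m-1), …, d, 0 from the m parts of a d-distinct partition of n
-- leaves an ordinary partition, determined by its multiset of parts. Re-sort that multiset
-- by the key (π⁻¹ of the residue class mod d, then size), both decreasing, and add the
-- staircase back. The parts after p in this key order are the N_s parts of lower classes
-- together with the smaller parts of p's own class; the latter lie below p in steps of at
-- least d, so the result has distinct parts, and "p exceeds d times the number of parts
-- after it" is equivalent to c_s.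
module Submission where

open import Level using (0ℓ)
open import Function using (id; _∘_)
open import Function.Bundles using (_↔_; mk↔ₛ′)
open import Function.Related.Propositional using (module EquationalReasoning; bijection)
open import Data.Unit using (⊤)
open import Data.Product using (∃; _×_; _,_; proj₁; proj₂)
open import Data.Sum using (_⊎_; inj₁; inj₂)
open import Data.Nat
  using (ℕ; zero; suc; _+_; _*_; _∸_; _≤_; _<_; _≥_; z≤n; s≤s; NonZero; >-nonZero⁻¹)
open import Data.Nat.Properties
open import Data.Nat.DivMod using (_%_; _/_; _mod_; m≡m%n+[m/n]*n; [m+kn]%n≡m%n; m%n<n)
open import Data.Nat.ListAction using (sum)
open import Data.Nat.ListAction.Properties using (sum-↭)
open import Data.Fin using (Fin; toℕ; zero; suc)
open import Data.Fin.Properties using (toℕ-injective; toℕ-fromℕ<; any?)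
open import Data.Fin.Permutation using (Permutation′; _⟨$⟩ʳ_; _⟨$⟩ˡ_; inverseˡ; inverseʳ)
open import Data.List using (List; []; _∷_; length; filter)
open import Data.List.Properties using (≡-dec; length-filter; filter-all; filter-reject)
open import Data.List.Membership.Propositional using (_∈_)
open import Data.List.Relation.Unary.Any using (here; there)
open import Data.List.Relation.Unary.All as All using (All; []; _∷_)
open import Data.List.Relation.Unary.AllPairs as AllPairs using (AllPairs; []; _∷_)
open import Data.List.Relation.Unary.Linked as Linked using (Linked; []; [-]; _∷_)
open import Data.List.Relation.Unary.Linked.Properties using (Linked⇒AllPairs)
open import Data.List.Relation.Unary.Unique.Propositional using (Unique)
open import Data.List.Relation.Binary.Permutation.Propositional using (_↭_; ↭-sym; ↭-trans; ↭⇒↭ₛ; ↭⇒↭ₛ′)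
open import Data.List.Relation.Binary.Permutation.Propositional.Properties
  using (filter-↭; ↭-length; All-resp-↭; ∈-resp-↭)
import Data.List.Relation.Binary.Permutation.Setoid.Properties as SetoidPermutation
open import Data.List.Relation.Binary.Pointwise using (Pointwise-≡⇒≡)
import Data.List.Relation.Unary.Sorted.TotalOrder.Properties as Sorted
open import Relation.Nullary using (¬_; Dec; contradiction)
open import Relation.Nullary.Decidable using (recompute; _⊎-dec_; _×-dec_)
open import Relation.Binary.Core using (Rel; _⇒_)
open import Relation.Binary.Definitions using (Transitive; _Respects_; tri<; tri≈; tri>)
open import Relation.Binary.Structures using (IsDecTotalOrder)
open import Relation.Binary.Bundles using (DecTotalOrder)
import Relation.Binary.Construct.Flip.EqAndOrd as Flip
open import Algebra.Properties.CommutativeSemigroup +-commutativeSemigroup using (x∙yz≈y∙xz)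
open import Relation.Binary.PropositionalEquality
  using (_≡_; _≢_; refl; sym; trans; cong; cong₂; subst; subst₂; setoid; isEquivalence; module ≡-Reasoning)

open import Defs

Positive : List ℕ → Set
Positive = All (1 ≤_)

≥-isDecTotalOrder : IsDecTotalOrder _≡_ _≥_
≥-isDecTotalOrder = Flip.isDecTotalOrder ≤-isDecTotalOrder

m%n≡k%n∧m<k⇒m+n≤k : ∀ {m k} n .{{_ : NonZero n}} → m % n ≡ k % n → m < k → m + n ≤ k
m%n≡k%n∧m<k⇒m+n≤k {m} {k} n eq m<k = begin
  m + n                   ≡⟨ cong (_+ n) (m≡m%n+[m/n]*n m n) ⟩
  m % n + m / n * n + n   ≡⟨ +-assoc (m % n) _ n ⟩
  m % n + (m / n * n + n) ≡⟨ cong₂ _+_ eq (+-comm (m / n * n) n) ⟩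
  k % n + suc (m / n) * n ≤⟨ +-monoʳ-≤ (k % n) (*-monoˡ-≤ n quotient<) ⟩
  k % n + k / n * n       ≡⟨ m≡m%n+[m/n]*n k n ⟨
  k                       ∎
  where
  open ≤-Reasoning
  quotient< : m / n < k / n
  quotient< = ≰⇒> λ k/n≤m/n → <⇒≱ m<k (begin
    k                 ≡⟨ m≡m%n+[m/n]*n k n ⟩
    k % n + k / n * n ≤⟨ +-monoʳ-≤ (k % n) (*-monoˡ-≤ n k/n≤m/n) ⟩
    k % n + m / n * n ≡⟨ cong (_+ m / n * n) eq ⟨
    m % n + m / n * n ≡⟨ m≡m%n+[m/n]*n m n ⟨
    m                 ∎)

Subset-≡ : {P : List ℕ → Set} {a b : Subset P} → .(Subset.parts a ≡ Subset.parts b) → a ≡ b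
Subset-≡ {a = l , _} {b = l′ , _} eq with recompute (≡-dec _≟_ l l′) eq
... | refl = refl

Subset-↔ : {P Q : List ℕ → Set} (f g : List ℕ → List ℕ) →
  (∀ {l} → P l → Q (f l)) → (∀ {l} → Q l → P (g l)) →
  (∀ {l} → P l → g (f l) ≡ l) → (∀ {l} → Q l → f (g l) ≡ l) →
  Subset P ↔ Subset Q
Subset-↔ f g f-Q g-P g∘f f∘g = mk↔ₛ′
  (λ (l , p) → f l , f-Q p) (λ (l , q) → g l , g-P q)
  (λ (_ , q) → Subset-≡ (f∘g q)) (λ (_ , p) → Subset-≡ (g∘f p))

Subset-cong : {P Q : List ℕ → Set} → (∀ {l} → P l → Q l) → (∀ {l} → Q l → P l) → Subset P ↔ Subset Q
Subset-cong P⇒Q Q⇒P = Subset-↔ id id P⇒Q Q⇒P (λ _ → refl) (λ _ → refl)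

module Sorting {R : Rel ℕ 0ℓ} (isDecTotalOrder : IsDecTotalOrder _≡_ R) where

  private
    O : DecTotalOrder 0ℓ 0ℓ 0ℓ
    O = record { isDecTotalOrder = isDecTotalOrder }

  open import Data.List.Sort O public using (sort; sort-↭; sort-↗)

  ↗↭↗⇒≡ : ∀ {xs ys} → Linked R xs → Linked R ys → xs ↭ ys → xs ≡ ys
  ↗↭↗⇒≡ xs↗ ys↗ xs↭ys = Pointwise-≡⇒≡
    (Sorted.↗↭↗⇒≋ (DecTotalOrder.totalOrder O) xs↗ ys↗ (↭⇒↭ₛ′ isEquivalence xs↭ys))

  sort-cong-↭ : ∀ {xs ys} → xs ↭ ys → sort xs ≡ sort ys
  sort-cong-↭ {xs} {ys} xs↭ys =
    ↗↭↗⇒≡ (sort-↗ xs) (sort-↗ ys) (↭-trans (sort-↭ xs) (↭-trans xs↭ys (↭-sym (sort-↭ ys))))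

  sort-↗-id : ∀ {xs} → Linked R xs → sort xs ≡ xs
  sort-↗-id {xs} xs↗ = ↗↭↗⇒≡ (sort-↗ xs) xs↗ (sort-↭ xs)

resort-↔ : {R S : Rel ℕ 0ℓ} → IsDecTotalOrder _≡_ R → IsDecTotalOrder _≡_ S →
  {Q : List ℕ → Set} → Q Respects _↭_ →
  Subset (λ l → Linked R l × Q l) ↔ Subset (λ l → Linked S l × Q l)
resort-↔ R-order S-order Q-resp = Subset-↔ ByS.sort ByR.sort
  (λ {l} (_ , q) → ByS.sort-↗ l , Q-resp (↭-sym (ByS.sort-↭ l)) q)
  (λ {l} (_ , q) → ByR.sort-↗ l , Q-resp (↭-sym (ByR.sort-↭ l)) q)
  (λ {l} (l↗ , _) → trans (ByR.sort-cong-↭ (ByS.sort-↭ l)) (ByR.sort-↗-id l↗))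
  (λ {l} (l↗ , _) → trans (ByS.sort-cong-↭ (ByR.sort-↭ l)) (ByS.sort-↗-id l↗))
  where
  module ByR = Sorting R-order
  module ByS = Sorting S-order

Linked-strict⇒Unique : {S : Rel ℕ 0ℓ} → Transitive S → S ⇒ _≢_ → ∀ {l} → Linked S l → Unique l
Linked-strict⇒Unique S-trans S⇒≢ = AllPairs.map S⇒≢ ∘ Linked⇒AllPairs S-trans

Linked∧Unique⇒Linked-strict : {R S : Rel ℕ 0ℓ} → (∀ {x y} → R x y → x ≢ y → S x y) →
  ∀ {l} → Linked R l → Unique l → Linked S l
Linked∧Unique⇒Linked-strict strict [] _ = []
Linked∧Unique⇒Linked-strict strict [-] _ = [-]
Linked∧Unique⇒Linked-strict strict (r ∷ rs) ((x≢y ∷ _) ∷ u) =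
  strict r x≢y ∷ Linked∧Unique⇒Linked-strict strict rs u

Unique-resp-↭ : Unique {A = ℕ} Respects _↭_
Unique-resp-↭ = SetoidPermutation.Unique-resp-↭ (setoid ℕ) ∘ ↭⇒↭ₛ

Gap : ℕ → ℕ → ℕ → Set
Gap e a b = b + e ≤ a

Gap-trans : ∀ e → Transitive (Gap e)
Gap-trans e {a} {b} {c} b+e≤a c+e≤b = ≤-trans c+e≤b (≤-trans (m≤m+n b e) b+e≤a)

Gap⇒≥ : ∀ e → Gap e ⇒ _≥_
Gap⇒≥ e {a} {b} b+e≤a = ≤-trans (m≤m+n b e) b+e≤a

Gap1⇒≢ : Gap 1 ⇒ _≢_
Gap1⇒≢ {_} {b} b+1≤a refl = <-irrefl refl (subst (_≤ b) (+-comm b 1) b+1≤a)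

≥∧≢⇒Gap1 : ∀ {a b} → a ≥ b → a ≢ b → Gap 1 a b
≥∧≢⇒Gap1 {a} {b} b≤a a≢b = subst (_≤ a) (+-comm 1 b) (≤∧≢⇒< b≤a (a≢b ∘ sym))

Linked⇒DDistinct : ∀ e {l} → Linked (Gap e) l → DDistinct e l
Linked⇒DDistinct e {x ∷ xs} gaps zero (suc j) _ =
  Linked.lookup (Gap-trans e) (Linked.tail gaps) (Linked.head′ gaps) j
Linked⇒DDistinct e {x ∷ xs} gaps (suc i) (suc j) (s≤s i<j) =
  Linked⇒DDistinct e (Linked.tail gaps) i j i<j

DDistinct⇒Linked : ∀ e l → DDistinct e l → Linked (Gap e) l
DDistinct⇒Linked e [] _ = []
DDistinct⇒Linked e (x ∷ []) _ = [-]
DDistinct⇒Linked e (x ∷ y ∷ ys) dd =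
  dd zero (suc zero) (s≤s z≤n) ∷ DDistinct⇒Linked e (y ∷ ys) (λ i j i<j → dd (suc i) (suc j) (s≤s i<j))

-- Staircases

module Staircase (d : ℕ) where

  stair : List ℕ → List ℕ
  stair [] = []
  stair (x ∷ xs) = x + d * length xs ∷ stair xs

  unstair : List ℕ → List ℕ
  unstair [] = []
  unstair (x ∷ xs) = x ∸ d * length xs ∷ unstair xs

  AboveStair : List ℕ → Set
  AboveStair [] = ⊤
  AboveStair (x ∷ xs) = d * length xs < x × AboveStair xs

  length-stair : ∀ xs → length (stair xs) ≡ length xs
  length-stair [] = refl
  length-stair (x ∷ xs) = cong suc (length-stair xs)

  length-unstair : ∀ xs → length (unstair xs) ≡ length xs
  length-unstair [] = refl
  length-unstair (x ∷ xs) = cong suc (length-unstair xs)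

  unstair-stair : ∀ xs → unstair (stair xs) ≡ xs
  unstair-stair [] = refl
  unstair-stair (x ∷ xs) = cong₂ _∷_
    (trans (cong (λ m → x + d * length xs ∸ d * m) (length-stair xs)) (m+n∸n≡m x (d * length xs)))
    (unstair-stair xs)

  stair-unstair : ∀ {xs} → AboveStair xs → stair (unstair xs) ≡ xs
  stair-unstair {[]} _ = refl
  stair-unstair {x ∷ xs} (above , aboves) = cong₂ _∷_
    (trans (cong (λ m → x ∸ d * length xs + d * m) (length-unstair xs)) (m∸n+n≡m (<⇒≤ above)))
    (stair-unstair aboves)

  staircase : ℕ → ℕ
  staircase zero = 0
  staircase (suc m) = d * m + staircase m

  sum-stair : ∀ xs → sum (stair xs) ≡ sum xs + staircase (length xs)
  sum-stair [] = refl
  sum-stair (x ∷ xs) = begin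
    x + d * length xs + sum (stair xs)                     ≡⟨ cong (x + d * length xs +_) (sum-stair xs) ⟩
    x + d * length xs + (sum xs + staircase (length xs))   ≡⟨ +-assoc x _ _ ⟩
    x + (d * length xs + (sum xs + staircase (length xs))) ≡⟨ cong (x +_) (x∙yz≈y∙xz (d * length xs) (sum xs) _) ⟩
    x + (sum xs + (d * length xs + staircase (length xs))) ≡⟨ +-assoc x _ _ ⟨
    x + sum xs + staircase (length (x ∷ xs))               ∎
    where open ≡-Reasoning

  sum-stair-↭ : ∀ {xs ys} → xs ↭ ys → sum (stair xs) ≡ sum (stair ys)
  sum-stair-↭ {xs} {ys} xs↭ys = begin
    sum (stair xs)                  ≡⟨ sum-stair xs ⟩
    sum xs + staircase (length xs)  ≡⟨ cong₂ (λ s m → s + staircase m) (sum-↭ xs↭ys) (↭-length xs↭ys) ⟩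
    sum ys + staircase (length ys)  ≡⟨ sum-stair ys ⟨
    sum (stair ys)                  ∎
    where open ≡-Reasoning

  AboveStair-stair : ∀ {xs} → Positive xs → AboveStair (stair xs)
  AboveStair-stair {[]} _ = _
  AboveStair-stair {x ∷ xs} (x≥1 ∷ xs≥1) =
    subst (λ m → d * m < x + d * length xs) (sym (length-stair xs)) (+-monoˡ-≤ (d * length xs) x≥1) ,
    AboveStair-stair xs≥1

  AboveStair-stair⇒Positive : ∀ {xs} → AboveStair (stair xs) → Positive xs
  AboveStair-stair⇒Positive {[]} _ = []
  AboveStair-stair⇒Positive {x ∷ xs} (above , aboves) =
    +-cancelʳ-≤ (d * length xs) 1 x (subst (λ m → d * m < x + d * length xs) (length-stair xs) above) ∷
    AboveStair-stair⇒Positive aboves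

  AboveStair⇒Positive : ∀ {xs} → AboveStair xs → Positive xs
  AboveStair⇒Positive {[]} _ = []
  AboveStair⇒Positive {x ∷ xs} (above , aboves) = ≤-trans (s≤s z≤n) above ∷ AboveStair⇒Positive aboves

  AboveStair-step : ∀ {m a b} → d * m < b → Gap d a b → d * suc m < a
  AboveStair-step {m} {a} {b} dm<b b+d≤a = ≤-trans (subst (_≤ b + d) shift (+-monoˡ-≤ d dm<b)) b+d≤a
    where
    shift : suc (d * m) + d ≡ suc (d * suc m)
    shift = cong suc (trans (+-comm (d * m) d) (sym (*-suc d m)))

  Linked-Gap⇒AboveStair : ∀ {xs} → Linked (Gap d) xs → Positive xs → AboveStair xs
  Linked-Gap⇒AboveStair [] _ = _
  Linked-Gap⇒AboveStair {x ∷ []} [-] (x≥1 ∷ _) = subst (_< x) (sym (*-zeroʳ d)) x≥1 , _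
  Linked-Gap⇒AboveStair (gap ∷ gaps) (_ ∷ positive) =
    AboveStair-step (proj₁ above) gap , above
    where above = Linked-Gap⇒AboveStair gaps positive

  Linked-stair : {R S : Rel ℕ 0ℓ} → (∀ {x y} m → R x y → S (x + d * suc m) (y + d * m)) →
    ∀ {xs} → Linked R xs → Linked S (stair xs)
  Linked-stair step {[]} _ = []
  Linked-stair step {_ ∷ []} _ = [-]
  Linked-stair step {x ∷ y ∷ ys} (r ∷ rs) = step (length ys) r ∷ Linked-stair step rs

  Linked-stair⁻ : {R S : Rel ℕ 0ℓ} → (∀ {x y} m → S (x + d * suc m) (y + d * m) → R x y) →
    ∀ {xs} → Linked S (stair xs) → Linked R xs
  Linked-stair⁻ step⁻ {[]} _ = []
  Linked-stair⁻ step⁻ {_ ∷ []} _ = [-]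
  Linked-stair⁻ step⁻ {x ∷ y ∷ ys} (s ∷ ss) = step⁻ (length ys) s ∷ Linked-stair⁻ step⁻ ss

  stair-shift : ∀ y m → y + d * m + d ≡ y + d * suc m
  stair-shift y m = trans (+-assoc y (d * m) d) (cong (y +_) (trans (+-comm (d * m) d) (sym (*-suc d m))))

  stair-≥⇒Gap : ∀ {x y} m → x ≥ y → Gap d (x + d * suc m) (y + d * m)
  stair-≥⇒Gap {x} {y} m y≤x = subst (_≤ x + d * suc m) (sym (stair-shift y m)) (+-monoˡ-≤ (d * suc m) y≤x)

  stair-Gap⇒≥ : ∀ {x y} m → Gap d (x + d * suc m) (y + d * m) → x ≥ y
  stair-Gap⇒≥ {x} {y} m gap = +-cancelʳ-≤ (d * suc m) y x (subst (_≤ x + d * suc m) (stair-shift y m) gap)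

  Lowered : Rel ℕ 0ℓ → ℕ → List ℕ → Set
  Lowered R n ν = Linked R ν × Positive ν × sum (stair ν) ≡ n

  Raised : Rel ℕ 0ℓ → ℕ → List ℕ → Set
  Raised S n μ = Linked S μ × AboveStair μ × sum μ ≡ n

  stair-↔ : {R S : Rel ℕ 0ℓ} {n : ℕ} →
    (∀ {x y} m → R x y → S (x + d * suc m) (y + d * m)) →
    (∀ {x y} m → S (x + d * suc m) (y + d * m) → R x y) →
    Subset (Lowered R n) ↔ Subset (Raised S n)
  stair-↔ step step⁻ = Subset-↔ stair unstair
    (λ (r , positive , total) → Linked-stair step r , AboveStair-stair positive , total)
    (λ {μ} (s , above , total) → let μ≡ = stair-unstair above in
      Linked-stair⁻ step⁻ (subst (Linked _) (sym μ≡) s) ,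
      AboveStair-stair⇒Positive (subst AboveStair (sym μ≡) above) ,
      trans (cong sum μ≡) total)
    (λ {ν} _ → unstair-stair ν)
    (λ (_ , above , _) → stair-unstair above)

  Lowered-resp-↭ : ∀ n → (λ ν → Positive ν × sum (stair ν) ≡ n) Respects _↭_
  Lowered-resp-↭ n ν↭ν′ (positive , total) =
    All-resp-↭ ν↭ν′ positive , trans (sum-stair-↭ (↭-sym ν↭ν′)) total

-- Ordering by a rank, then by size, both decreasing

module KeyOrder (rank : ℕ → ℕ) where

  infix 4 _⊑_ _⊏_

  _⊑_ : Rel ℕ 0ℓ
  x ⊑ y = rank y < rank x ⊎ (rank y ≡ rank x × y ≤ x)

  _⊏_ : Rel ℕ 0ℓ
  x ⊏ y = rank y < rank x ⊎ (rank y ≡ rank x × y < x)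

  ⊑-trans : Transitive _⊑_
  ⊑-trans (inj₁ a) (inj₁ b) = inj₁ (<-trans b a)
  ⊑-trans (inj₁ a) (inj₂ (e , _)) = inj₁ (≤-<-trans (≤-reflexive e) a)
  ⊑-trans (inj₂ (e , _)) (inj₁ b) = inj₁ (<-≤-trans b (≤-reflexive e))
  ⊑-trans (inj₂ (e , p)) (inj₂ (e′ , q)) = inj₂ (trans e′ e , ≤-trans q p)

  ⊏-trans : Transitive _⊏_
  ⊏-trans (inj₁ a) (inj₁ b) = inj₁ (<-trans b a)
  ⊏-trans (inj₁ a) (inj₂ (e , _)) = inj₁ (≤-<-trans (≤-reflexive e) a)
  ⊏-trans (inj₂ (e , _)) (inj₁ b) = inj₁ (<-≤-trans b (≤-reflexive e))
  ⊏-trans (inj₂ (e , p)) (inj₂ (e′ , q)) = inj₂ (trans e′ e , <-trans q p)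

  ⊑-antisym : ∀ {x y} → x ⊑ y → y ⊑ x → x ≡ y
  ⊑-antisym (inj₁ a) (inj₁ b) = contradiction a (<-asym b)
  ⊑-antisym (inj₁ a) (inj₂ (e , _)) = contradiction a (<-irrefl (sym e))
  ⊑-antisym (inj₂ (e , _)) (inj₁ b) = contradiction b (<-irrefl (sym e))
  ⊑-antisym (inj₂ (_ , p)) (inj₂ (_ , q)) = ≤-antisym q p

  ⊑-total : ∀ x y → x ⊑ y ⊎ y ⊑ x
  ⊑-total x y with <-cmp (rank x) (rank y)
  ... | tri< a _ _ = inj₂ (inj₁ a)
  ... | tri> _ _ c = inj₁ (inj₁ c)
  ... | tri≈ _ e _ with ≤-total x y
  ...   | inj₁ p = inj₂ (inj₂ (e , p))
  ...   | inj₂ p = inj₁ (inj₂ (sym e , p))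

  ⊑-isDecTotalOrder : IsDecTotalOrder _≡_ _⊑_
  ⊑-isDecTotalOrder = record
    { isTotalOrder = record
      { isPartialOrder = record
        { isPreorder = record
          { isEquivalence = isEquivalence
          ; reflexive = λ { refl → inj₂ (refl , ≤-refl) }
          ; trans = ⊑-trans
          }
        ; antisym = ⊑-antisym
        }
      ; total = ⊑-total
      }
    ; _≟_ = _≟_
    ; _≤?_ = λ x y → (rank y <? rank x) ⊎-dec ((rank y ≟ rank x) ×-dec (y ≤? x))
    }

  ⊏⇒⊑ : _⊏_ ⇒ _⊑_
  ⊏⇒⊑ (inj₁ a) = inj₁ a
  ⊏⇒⊑ (inj₂ (e , p)) = inj₂ (e , <⇒≤ p)

  ⊏⇒≢ : _⊏_ ⇒ _≢_
  ⊏⇒≢ (inj₁ a) refl = <-irrefl refl a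
  ⊏⇒≢ (inj₂ (_ , p)) refl = <-irrefl refl p

  ⊑∧≢⇒⊏ : ∀ {x y} → x ⊑ y → x ≢ y → x ⊏ y
  ⊑∧≢⇒⊏ (inj₁ a) _ = inj₁ a
  ⊑∧≢⇒⊏ (inj₂ (e , p)) x≢y = inj₂ (e , ≤∧≢⇒< p (x≢y ∘ sym))

  ⊑⇒rank≥ : ∀ {x y} → x ⊑ y → rank y ≤ rank x
  ⊑⇒rank≥ (inj₁ a) = <⇒≤ a
  ⊑⇒rank≥ (inj₂ (e , _)) = ≤-reflexive e

module Bijection (d : ℕ) .{{_ : NonZero d}} (π : Permutation′ d) where

  open Staircase d

  class : ℕ → Fin d
  class p = π ⟨$⟩ˡ (p mod d)

  rank : ℕ → ℕ
  rank p = toℕ (class p)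

  open KeyOrder rank

  class-residue : ∀ p → p % d ≡ toℕ (π ⟨$⟩ʳ class p)
  class-residue p = trans (sym (toℕ-fromℕ< (m%n<n p d))) (cong toℕ (sym (inverseʳ π)))

  class-unique : ∀ {p} {s : Fin d} → p % d ≡ toℕ (π ⟨$⟩ʳ s) → class p ≡ s
  class-unique {p} eq = trans (cong (π ⟨$⟩ˡ_) (toℕ-injective (trans (toℕ-fromℕ< (m%n<n p d)) eq))) (inverseˡ π)

  rank-+ : ∀ p m → rank (p + d * m) ≡ rank p
  rank-+ p m = cong toℕ (class-unique (begin
    (p + d * m) % d ≡⟨ cong (λ k → (p + k) % d) (*-comm d m) ⟩
    (p + m * d) % d ≡⟨ [m+kn]%n≡m%n p m d ⟩
    p % d           ≡⟨ class-residue p ⟩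
    toℕ (π ⟨$⟩ʳ class p) ∎))
    where open ≡-Reasoning

  rank-gap : ∀ {p q} → rank q ≡ rank p → q < p → Gap d p q
  rank-gap {p} {q} same q<p = m%n≡k%n∧m<k⇒m+n≤k d residue q<p
    where
    residue : q % d ≡ p % d
    residue = trans (class-residue q) (trans (cong (λ s → toℕ (π ⟨$⟩ʳ s)) (toℕ-injective same)) (sym (class-residue p)))

  stair-⊑⇒⊏ : ∀ {x y} m → x ⊑ y → x + d * suc m ⊏ y + d * m
  stair-⊑⇒⊏ {x} {y} m (inj₁ lower) = inj₁ (subst₂ _<_ (sym (rank-+ y m)) (sym (rank-+ x (suc m))) lower)
  stair-⊑⇒⊏ {x} {y} m (inj₂ (same , y≤x)) =
    inj₂ (trans (rank-+ y m) (trans same (sym (rank-+ x (suc m)))) ,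
          <-≤-trans (m<m+n (y + d * m) (>-nonZero⁻¹ d)) (stair-≥⇒Gap m y≤x))

  stair-⊏⇒⊑ : ∀ {x y} m → x + d * suc m ⊏ y + d * m → x ⊑ y
  stair-⊏⇒⊑ {x} {y} m (inj₁ lower) = inj₁ (subst₂ _<_ (rank-+ y m) (rank-+ x (suc m)) lower)
  stair-⊏⇒⊑ {x} {y} m (inj₂ (same , y<x)) =
    inj₂ (trans (sym (rank-+ y m)) (trans same (rank-+ x (suc m))) , stair-Gap⇒≥ m (rank-gap same y<x))

  N : ℕ → List ℕ → ℕ
  N = Nₛ d π

  OfRankBelow : ℕ → ℕ → Set
  OfRankBelow s p = ∃ λ (k : Fin d) → toℕ k < s × p % d ≡ toℕ (π ⟨$⟩ʳ k)

  ofRankBelow? : ∀ s p → Dec (OfRankBelow s p)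
  ofRankBelow? s p = any? (λ k → (toℕ k <? s) ×-dec (p % d ≟ toℕ (π ⟨$⟩ʳ k)))

  N-reject : ∀ {s x} l → ¬ rank x < s → N s (x ∷ l) ≡ N s l
  N-reject {s} l rank≮s =
    cong length (filter-reject (ofRankBelow? s)
      λ (k , k<s , eq) → rank≮s (subst (λ c → toℕ c < s) (sym (class-unique eq)) k<s))

  N-all : ∀ {s} l → All (λ x → rank x < s) l → N s l ≡ length l
  N-all {s} l below =
    cong length (filter-all (ofRankBelow? s) (All.map (λ {x} r<s → class x , r<s , class-residue x) below))

  N-≤-length : ∀ s l → N s l ≤ length l
  N-≤-length s = length-filter (ofRankBelow? s)

  N-↭ : ∀ s {l l′} → l ↭ l′ → N s l ≡ N s l′
  N-↭ s = ↭-length ∘ filter-↭ (ofRankBelow? s)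

  N-zero : ∀ l → N 0 l ≡ 0
  N-zero [] = refl
  N-zero (x ∷ l) = trans (N-reject l λ ()) (N-zero l)

  N-∷-⊑ : ∀ {x q} l → x ⊑ q → N (rank q) (x ∷ l) ≡ N (rank q) l
  N-∷-⊑ l x⊑q = N-reject l (≤⇒≯ (⊑⇒rank≥ x⊑q))

  -- c_s for every rank s, including s = 0, where it just says that the parts are positive.
  RankConditions : List ℕ → Set
  RankConditions l = ∀ p → p ∈ l → d * N (rank p) l < p

  RankConditions-resp-↭ : RankConditions Respects _↭_
  RankConditions-resp-↭ l↭l′ conditions p p∈l′ =
    subst (λ c → d * c < p) (N-↭ (rank p) l↭l′) (conditions p (∈-resp-↭ (↭-sym l↭l′) p∈l′))

  RankConditions⇒Positive : ∀ {l} → RankConditions l → Positive l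
  RankConditions⇒Positive conditions = All.tabulate λ {p} p∈l → ≤-<-trans z≤n (conditions p p∈l)

  RankConditions⇒Conditions : ∀ {l} → RankConditions l → Conditions d π l
  RankConditions⇒Conditions {l} conditions s _ p p∈l eq =
    subst (λ c → d * N (toℕ c) l < p) (class-unique eq) (conditions p p∈l)

  Conditions⇒RankConditions : ∀ {l} → Positive l → Conditions d π l → RankConditions l
  Conditions⇒RankConditions {l} positive conditions p p∈l with rank p in rank≡
  ... | zero = subst (λ c → d * c < p) (sym (N-zero l)) (subst (_< p) (sym (*-zeroʳ d)) (All.lookup positive p∈l))
  ... | suc r = subst (λ s → d * N s l < p) rank≡
    (conditions (class p) (subst (1 ≤_) (sym rank≡) (s≤s z≤n)) p p∈l (class-residue p))

  RankConditions-tail : ∀ {x l} → All (x ⊑_) l → RankConditions (x ∷ l) → RankConditions l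
  RankConditions-tail {l = l} x⊑l conditions q q∈l =
    subst (λ c → d * c < q) (N-∷-⊑ l (All.lookup x⊑l q∈l)) (conditions q (there q∈l))

  -- Every part p is followed, in key order, only by parts of rank at most rank p.
  AboveStair⇒RankConditions : ∀ {w} → Linked _⊑_ w → AboveStair w → RankConditions w
  AboveStair⇒RankConditions {x ∷ w} _ (above , _) q (here refl) =
    subst (λ c → d * c < x) (sym (N-reject w (<-irrefl refl))) (≤-<-trans (*-monoʳ-≤ d (N-≤-length (rank x) w)) above)
  AboveStair⇒RankConditions {x ∷ w} sorted (_ , aboves) q (there q∈w) =
    subst (λ c → d * c < q) (sym (N-∷-⊑ w (All.lookup (AllPairs.head (Linked⇒AllPairs ⊑-trans sorted)) q∈w)))
      (AboveStair⇒RankConditions (Linked.tail sorted) aboves q q∈w)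

  -- The part after p either has smaller rank, and then so have all later parts, which are
  -- then exactly the N (rank p) parts counted by the condition on p; or it has p's residue,
  -- and then it lies at least d below p.
  RankConditions⇒AboveStair : ∀ {u} → Linked _⊏_ u → RankConditions u → AboveStair u
  RankConditions⇒AboveStair [] _ = _
  RankConditions⇒AboveStair {p ∷ []} [-] conditions =
    subst (λ c → d * c < p) (N-reject [] (<-irrefl refl)) (conditions p (here refl)) , _
  RankConditions⇒AboveStair {p ∷ q ∷ u} (p⊏q ∷ sorted) conditions = head p⊏q , above
    where
    p⊑later : AllPairs _⊑_ (p ∷ q ∷ u)
    p⊑later = Linked⇒AllPairs ⊑-trans (Linked.map ⊏⇒⊑ (p⊏q ∷ sorted))
    above : AboveStair (q ∷ u)
    above = RankConditions⇒AboveStair sorted (RankConditions-tail (AllPairs.head p⊑later) conditions)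
    head : p ⊏ q → d * length (q ∷ u) < p
    head (inj₁ lower) =
      subst (λ c → d * c < p) (trans (N-reject (q ∷ u) (<-irrefl refl)) (N-all (q ∷ u) later-lower))
        (conditions p (here refl))
      where
      later-lower : All (λ x → rank x < rank p) (q ∷ u)
      later-lower = lower ∷ All.map (λ q⊑x → ≤-<-trans (⊑⇒rank≥ q⊑x) lower) (AllPairs.head (AllPairs.tail p⊑later))
    head (inj₂ (same , q<p)) = AboveStair-step (proj₁ above) (rank-gap same q<p)

  CondParts : ℕ → List ℕ → Set
  CondParts n l = Unique l × RankConditions l × sum l ≡ n

  CondParts-resp-↭ : ∀ n → CondParts n Respects _↭_
  CondParts-resp-↭ n l↭l′ (unique , conditions , total) =
    Unique-resp-↭ l↭l′ unique , RankConditions-resp-↭ l↭l′ conditions , trans (sym (sum-↭ l↭l′)) total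

  DDistinct↔Raised : ∀ n → DDistinctPartition d n ↔ Subset (Raised (Gap d) n)
  DDistinct↔Raised n = Subset-cong
    (λ {μ} ((_ , positive , total) , dd) → let gaps = DDistinct⇒Linked d μ dd in
      gaps , Linked-Gap⇒AboveStair gaps positive , total)
    (λ (gaps , above , total) →
      (Linked.map (Gap⇒≥ d) gaps , AboveStair⇒Positive above , total) , Linked⇒DDistinct d gaps)

  Raised↔CondParts : ∀ n → Subset (Raised _⊏_ n) ↔ Subset (λ l → Linked _⊑_ l × CondParts n l)
  Raised↔CondParts n = Subset-cong
    (λ (sorted , above , total) → let sorted′ = Linked.map ⊏⇒⊑ sorted in
      sorted′ , Linked-strict⇒Unique ⊏-trans ⊏⇒≢ sorted , AboveStair⇒RankConditions sorted′ above , total)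
    (λ (sorted , unique , conditions , total) → let sorted′ = Linked∧Unique⇒Linked-strict ⊑∧≢⇒⊏ sorted unique in
      sorted′ , RankConditions⇒AboveStair sorted′ conditions , total)

  CondParts↔CondPartition : ∀ n → Subset (λ l → Linked _≥_ l × CondParts n l) ↔ CondPartition d π n
  CondParts↔CondPartition n = Subset-cong
    (λ (sorted , unique , conditions , total) →
      ((sorted , RankConditions⇒Positive conditions , total) ,
       Linked⇒DDistinct 1 (Linked∧Unique⇒Linked-strict ≥∧≢⇒Gap1 sorted unique)) ,
      RankConditions⇒Conditions conditions)
    (λ {l} (((sorted , positive , total) , distinct) , conditions) →
      sorted , Linked-strict⇒Unique (Gap-trans 1) Gap1⇒≢ (DDistinct⇒Linked 1 l distinct) ,
      Conditions⇒RankConditions positive conditions , total)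

  DDistinct↔CondPartition : ∀ n → DDistinctPartition d n ↔ CondPartition d π n
  DDistinct↔CondPartition n = begin
    DDistinctPartition d n                           ↔⟨ DDistinct↔Raised n ⟩
    Subset (Raised (Gap d) n)                        ↔⟨ stair-↔ stair-≥⇒Gap stair-Gap⇒≥ ⟨
    Subset (Lowered _≥_ n)                           ↔⟨ resort-↔ ≥-isDecTotalOrder ⊑-isDecTotalOrder (Lowered-resp-↭ n) ⟩
    Subset (Lowered _⊑_ n)                           ↔⟨ stair-↔ stair-⊑⇒⊏ stair-⊏⇒⊑ ⟩
    Subset (Raised _⊏_ n)                            ↔⟨ Raised↔CondParts n ⟩
    Subset (λ l → Linked _⊑_ l × CondParts n l)      ↔⟨ resort-↔ ⊑-isDecTotalOrder ≥-isDecTotalOrder (CondParts-resp-↭ n) ⟩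
    Subset (λ l → Linked _≥_ l × CondParts n l)      ↔⟨ CondParts↔CondPartition n ⟩
    CondPartition d π n                              ∎
    where open EquationalReasoning {k = bijection}

mainTheorem2 : (n d : ℕ) .{{_ : NonZero d}} → 1 ≤ n → (π : Permutation′ d) →
    DDistinctPartition d n ↔ CondPartition d π n
mainTheorem2 n d _ π = Bijection.DDistinct↔CondPartition d π n
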